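{- For every set of constants $\mathbb{A}$ and every $\mathbb{A}$-environment $\zeta$, the type interpretation $[\![\cdot]\!]_\zeta$ satisfies the following: (1) $[\![{\sf U}]\!]_\zeta=[\![A\to{\sf U}]\!]_\zeta$ for all types $A$; (2) $[\![(B\to A)\cap(B\to A')]\!]_\zeta=[\![B\to A\cap A']\!]_\zeta$ for all $A,A',B$; (3) if $[\![B']\!]_\zeta\subseteq[\![B]\!]_\zeta$ and $[\![A]\!]_\zeta\subseteq[\![A']\!]_\zeta$ then $[\![B\to A]\!]_\zeta\subseteq[\![B'\to A']\!]_\zeta$; (4) if $[\![{\sf U}]\!]_\zeta\subseteq[\![B\to A]\!]_\zeta$ then $[\![{\sf U}]\!]_\zeta\subseteq[\![A]\!]_\zeta$.
   Context: Intersection types over constants $\mathbb{A}$ and ${\sf U}$: $A::={\sf c}\mid{\sf U}\mid A\to A\mid A\cap A$. $\Lambda$ is the set of all untyped $\lambda$-terms, $\mathcal{S}$ the set of solvable terms, $\mathcal{B}=\{M\mid M\to^*_\beta xM_1\cdots M_m\}$ for variables $x$ and terms $M_i$. A set $X\subseteq\mathcal{S}$ is saturated if it is closed under $\beta$-conversion and contains all terms $xM_1\cdots M_m$. $\mathcal{S\!\Lambda}$ is the set of saturated $X$ with $\mathcal{B}\subseteq X\subseteq\mathcal{S}$ together with $\Lambda$. For $X,Y\in\mathcal{S\!\Lambda}$, $X\Rightarrow Y=\{M\in\Lambda\mid\forall N\in X.\ MN\in Y\}$. An $\mathbb{A}$-environment is a map $\zeta:\mathbb{A}\to\mathcal{S\!\Lambda}$,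 and its type interpretation is defined by $[\![{\sf U}]\!]_\zeta=\Lambda$, $[\![{\sf c}]\!]_\zeta=\zeta({\sf c})$, $[\![A\to B]\!]_\zeta=[\![A]\!]_\zeta\Rightarrow[\![B]\!]_\zeta$, $[\![A\cap B]\!]_\zeta=[\![A]\!]_\zeta\cap[\![B]\!]_\zeta$. -}

module Defs where

open import Level using (0ℓ)
open import Data.Nat using (ℕ; zero; suc; _<_; _≡ᵇ_; _<ᵇ_; pred)
open import Data.Bool using (if_then_else_)
open import Data.List using (List; foldl)
open import Data.Product using (Σ; _×_; ∃; ∃-syntax)
open import Data.Sum using (_⊎_)
open import Relation.Unary using (Pred; _∈_; _⊆_)
import Relation.Unary as Set
open import Relation.Binary.Construct.Closure.ReflexiveTransitive using (Star)
open import Relation.Binary.Construct.Closure.Equivalence using (EqClosure)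

infixl 7 _·_
data Λ : Set where
  var : ℕ → Λ
  ƛ   : Λ → Λ
  _·_ : Λ → Λ → Λ

shift : ℕ → Λ → Λ
shift c (var n) = if n <ᵇ c then var n else var (suc n)
shift c (ƛ M)   = ƛ (shift (suc c) M)
shift c (M · N) = shift c M · shift c N

sub : ℕ → Λ → Λ → Λ
sub k N (var n) = if n ≡ᵇ k then N else (if k <ᵇ n then var (pred n) else var n)
sub k N (ƛ M)   = ƛ (sub (suc k) (shift 0 N) M)
sub k N (M · M') = sub k N M · sub k N M'

infix 4 _→β_
data _→β_ : Λ → Λ → Set where
  β     : ∀ {M N} → (ƛ M) · N →β sub 0 N M
  ξƛ    : ∀ {M M'} → M →β M' → ƛ M →β ƛ M'
  ξappˡ : ∀ {M M' N} → M →β M' → M · N →β M' · N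
  ξappʳ : ∀ {M N N'} → N →β N' → M · N →β M · N'

_↠β_ : Λ → Λ → Set
_↠β_ = Star _→β_

_=β_ : Λ → Λ → Set
_=β_ = EqClosure _→β_

_··_ : Λ → List Λ → Λ
M ·· Ns = foldl _·_ M Ns

lams : ℕ → Λ → Λ
lams zero    M = M
lams (suc n) M = ƛ (lams n M)

Bound : ℕ → Λ → Set
Bound k (var n) = n < k
Bound k (ƛ M)   = Bound (suc k) M
Bound k (M · N) = Bound k M × Bound k N

I : Λ
I = ƛ (var 0)

-- Solvable (Barendregt): the closure λx⃗.M of M is solvable,
-- i.e. (λx⃗.M) N⃗ =β I for some terms N⃗.
Solvable : Pred Λ 0ℓ
Solvable M = ∃[ n ] ∃[ Ns ] (Bound n M × (lams n M ·· Ns) =β I)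

ℬ : Pred Λ 0ℓ
ℬ M = ∃[ x ] ∃[ Ms ] (M ↠β (var x ·· Ms))

Saturated : Pred Λ 0ℓ → Set
Saturated X =
  (X ⊆ Solvable) ×
  (∀ {M N} → M =β N → M ∈ X → N ∈ X) ×
  (∀ x Ms → (var x ·· Ms) ∈ X)

Full : Pred Λ 0ℓ → Set
Full X = ∀ M → M ∈ X

Inℱ : Pred Λ 0ℓ → Set
Inℱ X = (Saturated X × ℬ ⊆ X × X ⊆ Solvable) ⊎ Full X

record SΛ : Set₁ where
  constructor mkSΛ
  field
    carrier : Pred Λ 0ℓ
    isSΛ    : Inℱ carrier
open SΛ public

infixr 5 _⟹_
_⟹_ : Pred Λ 0ℓ → Pred Λ 0ℓ → Pred Λ 0ℓ
(X ⟹ Y) M = ∀ N → N ∈ X → (M · N) ∈ Y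

infixr 5 _⇒ₜ_
infixl 6 _∩ₜ_
data Ty (𝔸 : Set) : Set where
  con  : 𝔸 → Ty 𝔸
  U    : Ty 𝔸
  _⇒ₜ_ : Ty 𝔸 → Ty 𝔸 → Ty 𝔸
  _∩ₜ_ : Ty 𝔸 → Ty 𝔸 → Ty 𝔸

Env : Set → Set₁
Env 𝔸 = 𝔸 → SΛ

⟦_⟧_ : {𝔸 : Set} → Ty 𝔸 → Env 𝔸 → Pred Λ 0ℓ
⟦ con c ⟧ ζ       = carrier (ζ c)
⟦ U ⟧ ζ           = Set.U
(⟦ A ⇒ₜ B ⟧ ζ)    = (⟦ A ⟧ ζ) ⟹ (⟦ B ⟧ ζ)
⟦ A ∩ₜ B ⟧ ζ      = (⟦ A ⟧ ζ) Set.∩ (⟦ B ⟧ ζ)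

{-# OPTIONS --safe #-}
-- Parts (1)–(3) hold for the arrow ⟹ on arbitrary predicates. For (4), given any
-- term M, the constant function ƛ (shift 0 M) lies in ⟦ U ⟧ ⊆ ⟦ B ⇒ₜ A ⟧; applied to
-- a variable, which inhabits every interpretation, it yields a term that β-reduces
-- to M, and every interpretation is closed under β-reduction.
module Submission where

open import Level using (0ℓ)
open import Defs
open import Data.Bool using (true; false)
open import Data.List using (List; []; _∷ʳ_)
open import Data.List.Properties using (foldl-∷ʳ)
open import Data.Nat using (zero; suc; _<ᵇ_; _≡ᵇ_)
open import Data.Product using (_×_; _,_; proj₁; proj₂)
open import Data.Sum using (inj₁; inj₂)
open import Data.Unit using (tt)
open import Relation.Binary.Construct.Closure.ReflexiveTransitive using (ε; _◅_)
open import Relation.Binary.Construct.Closure.Symmetric using (fwd)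
open import Relation.Binary.PropositionalEquality using (_≡_; refl; cong; cong₂; subst)
open import Relation.Unary using (Pred; _∈_; _⊆_; _≐_; _∩_)
import Relation.Unary as Set

<ᵇ⇒≢ᵇ×≯ᵇ : ∀ m n → (m <ᵇ n) ≡ true → (m ≡ᵇ n) ≡ false × (n <ᵇ m) ≡ false
<ᵇ⇒≢ᵇ×≯ᵇ zero    (suc n) _   = refl , refl
<ᵇ⇒≢ᵇ×≯ᵇ (suc m) (suc n) m<n = <ᵇ⇒≢ᵇ×≯ᵇ m n m<n

≮ᵇ⇒suc≢ᵇ×<ᵇsuc : ∀ m n → (m <ᵇ n) ≡ false → (suc m ≡ᵇ n) ≡ false × (n <ᵇ suc m) ≡ true
≮ᵇ⇒suc≢ᵇ×<ᵇsuc m       zero    _   = refl , refl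
≮ᵇ⇒suc≢ᵇ×<ᵇsuc (suc m) (suc n) m≮n = ≮ᵇ⇒suc≢ᵇ×<ᵇsuc m n m≮n

sub-shift : ∀ k N M → sub k N (shift k M) ≡ M
sub-shift k N (var n) with n <ᵇ k in n<k
... | true  rewrite proj₁ (<ᵇ⇒≢ᵇ×≯ᵇ n k n<k) | proj₂ (<ᵇ⇒≢ᵇ×≯ᵇ n k n<k) = refl
... | false rewrite proj₁ (≮ᵇ⇒suc≢ᵇ×<ᵇsuc n k n<k) | proj₂ (≮ᵇ⇒suc≢ᵇ×<ᵇsuc n k n<k) = refl
sub-shift k N (ƛ M)    = cong ƛ (sub-shift (suc k) (shift 0 N) M)
sub-shift k N (M · M') = cong₂ _·_ (sub-shift k N M) (sub-shift k N M')

β-const : ∀ M N → ƛ (shift 0 M) · N →β M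
β-const M N = subst (ƛ (shift 0 M) · N →β_) (sub-shift 0 N M) β

U≐⟹U : {X : Pred Λ 0ℓ} → Set.U ≐ (X ⟹ Set.U)
U≐⟹U = (λ _ _ _ → tt) , (λ _ → tt)

⟹-∩-distrib : {X Y Z : Pred Λ 0ℓ} → (X ⟹ Y) ∩ (X ⟹ Z) ≐ (X ⟹ Y ∩ Z)
⟹-∩-distrib = (λ (f , g) N n → f N n , g N n)
             , (λ h → (λ N n → proj₁ (h N n)) , (λ N n → proj₂ (h N n)))

⟹-mono : {X X' Y Y' : Pred Λ 0ℓ} → X' ⊆ X → Y ⊆ Y' → (X ⟹ Y) ⊆ (X' ⟹ Y')
⟹-mono X'⊆X Y⊆Y' f N n = Y⊆Y' (f N (X'⊆X n))

carrier-→β-closed : ∀ (X : SΛ) {M M'} → M →β M' → M ∈ carrier X → M' ∈ carrier X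
carrier-→β-closed X M→M' m with isSΛ X
... | inj₁ ((_ , =β-closed , _) , _) = =β-closed (fwd M→M' ◅ ε) m
... | inj₂ full                      = full _

carrier-var·· : ∀ (X : SΛ) x Ms → (var x ·· Ms) ∈ carrier X
carrier-var·· X x Ms with isSΛ X
... | inj₁ ((_ , _ , vars) , _) = vars x Ms
... | inj₂ full                 = full _

module _ {𝔸 : Set} (ζ : Env 𝔸) where

  ⟦⟧-→β-closed : ∀ (A : Ty 𝔸) {M M'} → M →β M' → M ∈ ⟦ A ⟧ ζ → M' ∈ ⟦ A ⟧ ζ
  ⟦⟧-→β-closed (con c)  M→M' m       = carrier-→β-closed (ζ c) M→M' m
  ⟦⟧-→β-closed U        M→M' _       = tt
  ⟦⟧-→β-closed (A ⇒ₜ B) M→M' f N n   = ⟦⟧-→β-closed B (ξappˡ M→M') (f N n)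
  ⟦⟧-→β-closed (A ∩ₜ B) M→M' (a , b) = ⟦⟧-→β-closed A M→M' a , ⟦⟧-→β-closed B M→M' b

  ⟦⟧-var·· : ∀ (A : Ty 𝔸) x (Ms : List Λ) → (var x ·· Ms) ∈ ⟦ A ⟧ ζ
  ⟦⟧-var·· (con c)  x Ms     = carrier-var·· (ζ c) x Ms
  ⟦⟧-var·· U        x Ms     = tt
  ⟦⟧-var·· (A ⇒ₜ B) x Ms N _ =
    subst (⟦ B ⟧ ζ) (foldl-∷ʳ _·_ (var x) N Ms) (⟦⟧-var·· B x (Ms ∷ʳ N))
  ⟦⟧-var·· (A ∩ₜ B) x Ms     = ⟦⟧-var·· A x Ms , ⟦⟧-var·· B x Ms

  U⊆⟦⇒ₜ⟧⇒U⊆⟦codomain⟧ : ∀ (A B : Ty 𝔸) → Set.U ⊆ ⟦ B ⇒ₜ A ⟧ ζ → Set.U ⊆ ⟦ A ⟧ ζ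
  U⊆⟦⇒ₜ⟧⇒U⊆⟦codomain⟧ A B U⊆B⇒A {M} _ =
    ⟦⟧-→β-closed A (β-const M (var 0)) (U⊆B⇒A tt (var 0) (⟦⟧-var·· B 0 []))

proposition40 : {𝔸 : Set} (ζ : Env 𝔸) →
    (∀ (A : Ty 𝔸) → (⟦ U ⟧ ζ) ≐ (⟦ A ⇒ₜ U ⟧ ζ)) ×
    (∀ (A A' B : Ty 𝔸) →
      (⟦ (B ⇒ₜ A) ∩ₜ (B ⇒ₜ A') ⟧ ζ) ≐ (⟦ B ⇒ₜ (A ∩ₜ A') ⟧ ζ)) ×
    (∀ (A A' B B' : Ty 𝔸) →
      (⟦ B' ⟧ ζ) ⊆ (⟦ B ⟧ ζ) → (⟦ A ⟧ ζ) ⊆ (⟦ A' ⟧ ζ) →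
      (⟦ B ⇒ₜ A ⟧ ζ) ⊆ (⟦ B' ⇒ₜ A' ⟧ ζ)) ×
    (∀ (A B : Ty 𝔸) →
      (⟦ U ⟧ ζ) ⊆ (⟦ B ⇒ₜ A ⟧ ζ) → (⟦ U ⟧ ζ) ⊆ (⟦ A ⟧ ζ))
proposition40 ζ =
    (λ _ → U≐⟹U)
  , (λ A A' _ → ⟹-∩-distrib {Y = ⟦ A ⟧ ζ} {Z = ⟦ A' ⟧ ζ})
  , (λ _ _ _ _ → ⟹-mono)
  , U⊆⟦⇒ₜ⟧⇒U⊆⟦codomain⟧ ζ
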